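{- Let $\mathbb{K}=(G,M,I)$ be a formal context and $m\in M$ with $R:=m^{(I)}\neq\emptyset$, and let $\mathcal{S}$ be a complete system of $R$-mixed generators in $\mathbb{K}$. For each $g\in R$ consider the classes $\mathcal{N},\mathcal{A},\mathcal{B},\mathcal{C},\mathcal{C}^R,\mathcal{C}^{\neg R},\mathcal{A}^{\chi=R}$ of $\mathcal{S}$ defined with respect to $\mathbb{L}=\mathrm{op}^{g,m}(\mathbb{K})$. Then the classes $\mathcal{A}^{\chi=R}$ and $\mathcal{C}^R$ do not depend on the choice of $g\in R$. Moreover, for every $S\in\mathcal{S}$ (and every choice of $g\in R$): $S\in\mathcal{N}\cup\mathcal{A}$ if and only if $\chi(S)=\chi(S\setminus R)$, and $S\in\mathcal{B}\cup\mathcal{C}$ if and only if $\chi(S)\subsetneq\chi(S\setminus R)$. In particular, $\mathcal{B}\cup\mathcal{C}^{\neg R}$ does not depend on the choice of $g\in R$.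
   Context: A formal context is $(G,M,I)$ with $I\subseteq G\times M$. For $A\subseteq G$, $A^I=\{n\in M:(a,n)\in I\ \forall a\in A\}$ and dually for $B\subseteq M$; same notation for other incidence relations. For $n\in M$, $n^{(I)}:=G\setminus n^I$; for $h\in G$, $h^{(I)}:=M\setminus h^I$. For $(g,m)\notin I$, $\mathrm{op}^{g,m}(\mathbb{K})=(G,M,J)$ with $J=I\cup\{(g,n):n\in M\setminus\{m\}\}\cup\{(h,m):h\in G\setminus\{g\}\}$. For $R\subseteq G$, $S\subseteq G$ is an $R$-mixed generator in $(G,M,I)$ if for every $h\in G$: (i) $h\in S\cap R\Rightarrow(S\setminus\{h\})^{II}\neq S^{II}$; (ii) $h\notin S\cup R\Rightarrow(S\cup\{h\})^{II}\neq S^{II}$; in $(G,M,J)$ likewise with $J$ and the same $R$. A complete system of $R$-mixed generators is a family of $R$-mixed generators such that $S\mapsto S^{II}$ is a bijection onto the set of extents of $\mathbb{K}$. $S$ strongly avoids $h$ if $S^I\cap(h^{(I)}\setminus\{m\})\neq\emptyset$ (computed with $I$); $\chi(S)=\{h\in R:S\text{ strongly avoids }h\}$. Classes (with $\mathbb{L}=(G,M,J)$): $\mathcal{N}=\{S\in\mathcal{S}:S\text{ not an }R\text{ -mixed generator in }\mathbb{L}\}$; $\mathcal{A}=\{S\in\mathcal{S}\setminus\mathcal{N}:S^J=S^I\}$; $\mathcal{B}=\{S\in\mathcal{S}\setminus\mathcal{N}:S^J\neq S^I,(S\cup\{g\})^J=S^I\}$; $\mathcal{C}=\{S\in\mathcal{S}\setminus\mathcal{N}:S^J\neq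 S^I,(S\cup\{g\})^J\neq S^I\}$; $\mathcal{C}^R=\{S\in\mathcal{C}:R\subseteq S\}$; $\mathcal{C}^{\neg R}=\{S\in\mathcal{C}:R\not\subseteq S\}$; $\mathcal{A}^{\chi=R}=\{S\in\mathcal{A}:\chi(S)=R\}$. -}

module Defs where

open import Data.Nat using (ℕ; zero; suc)
open import Data.Bool using (Bool; true; false; not; _∧_; _∨_)
open import Data.Fin using (Fin; zero; suc; _≟_)
open import Data.Fin.Subset using (Subset; _∈_; _∉_; _⊆_; _⊂_; _∩_; _∪_; _─_; _-_; ⁅_⁆; ∁)
open import Data.Vec using (Vec; tabulate; lookup)
open import Data.Product using (_×_; ∃)
open import Relation.Nullary using (¬_)
open import Relation.Nullary.Decidable using (⌊_⌋)
open import Relation.Binary.PropositionalEquality using (_≡_; _≢_)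

allᵇ : {n : ℕ} → (Fin n → Bool) → Bool
allᵇ {zero}  p = true
allᵇ {suc n} p = p zero ∧ allᵇ (λ i → p (suc i))

anyᵇ : {n : ℕ} → (Fin n → Bool) → Bool
anyᵇ {zero}  p = false
anyᵇ {suc n} p = p zero ∨ anyᵇ (λ i → p (suc i))

-- A (finite) formal context (G, M, I) with G = Fin n objects, M = Fin k attributes;
-- (a , b) ∈ I  iff  I a b ≡ true.
Incidence : ℕ → ℕ → Set
Incidence n k = Fin n → Fin k → Bool

module _ {n k : ℕ} where

  up : Incidence n k → Subset n → Subset k
  up I A = tabulate (λ b → allᵇ (λ a → not (lookup A a) ∨ I a b))

  down : Incidence n k → Subset k → Subset n
  down I B = tabulate (λ a → allᵇ (λ b → not (lookup B b) ∨ I a b))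

  cl : Incidence n k → Subset n → Subset n
  cl I A = down I (up I A)

  IsExtent : Incidence n k → Subset n → Set
  IsExtent I E = cl I E ≡ E

  attrCo : Incidence n k → Fin k → Subset n
  attrCo I m = tabulate (λ a → not (I a m))

  objCo : Incidence n k → Fin n → Subset k
  objCo I h = tabulate (λ b → not (I h b))

  op : Fin n → Fin k → Incidence n k → Incidence n k
  op g m I h b =
    I h b ∨ (⌊ h ≟ g ⌋ ∧ not ⌊ b ≟ m ⌋) ∨ (not ⌊ h ≟ g ⌋ ∧ ⌊ b ≟ m ⌋)

  MixedGen : Incidence n k → Subset n → Subset n → Set
  MixedGen I R S = (h : Fin n) →
      (h ∈ S × h ∈ R → cl I (S - h) ≢ cl I S)
    × (h ∉ S × h ∉ R → cl I (S ∪ ⁅ h ⁆) ≢ cl I S)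

  CompleteSystem : Incidence n k → Subset n → (Subset n → Set) → Set
  CompleteSystem I R 𝒮 =
      ((S : Subset n) → 𝒮 S → MixedGen I R S)
    × ((S T : Subset n) → 𝒮 S → 𝒮 T → cl I S ≡ cl I T → S ≡ T)
    × ((E : Subset n) → IsExtent I E → ∃ (λ S → 𝒮 S × cl I S ≡ E))

  χ : Incidence n k → Fin k → Subset n → Subset n
  χ I m S = tabulate (λ h →
    lookup (attrCo I m) h ∧
    anyᵇ (λ b → lookup (up I S) b ∧ lookup (objCo I h) b ∧ not ⌊ b ≟ m ⌋))

  module Classes (I : Incidence n k) (m : Fin k) (g : Fin n) where
    R : Subset n
    R = attrCo I m

    J : Incidence n k
    J = op g m I

    𝒩 : Subset n → Set
    𝒩 S = ¬ MixedGen J R S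

    𝒜 : Subset n → Set
    𝒜 S = ¬ 𝒩 S × up J S ≡ up I S

    ℬ : Subset n → Set
    ℬ S = ¬ 𝒩 S × up J S ≢ up I S × up J (S ∪ ⁅ g ⁆) ≡ up I S

    𝒞 : Subset n → Set
    𝒞 S = ¬ 𝒩 S × up J S ≢ up I S × up J (S ∪ ⁅ g ⁆) ≢ up I S

    𝒞ᴿ : Subset n → Set
    𝒞ᴿ S = 𝒞 S × R ⊆ S

    𝒞¬ᴿ : Subset n → Set
    𝒞¬ᴿ S = 𝒞 S × ¬ (R ⊆ S)

    𝒜χ=R : Subset n → Set
    𝒜χ=R S = 𝒜 S × χ I m S ≡ R

module Submission where

-- For an R-mixed generator S of I the
-- classes 𝒩, 𝒜, ℬ, 𝒞 of L are governed by one property that does not mention g: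
-- whether S has a gap, i.e. an object of χ(S ─ R) outside χ(S).  Since always
-- χ(S) ⊆ χ(S ─ R), having a gap means χ(S) ⊂ χ(S ─ R).
--   * With a gap, S is an R-mixed generator of L and S^J ≠ S^I, so S ∈ ℬ ∪ 𝒞.
--     Both facts rest on gap⇒irredundant: no h ∈ S ∩ R has all attributes of
--     (S - h)^I ∖ {m}.
--   * Without a gap, an R-mixed generator of L has S^J = S^I, so S ∈ 𝒩 ∪ 𝒜.
-- Moreover χ(S) = R forces S ∩ R = ∅ and then S ∈ 𝒜, while ℬ contains no
-- superset of R; this separates 𝒞ᴿ from ℬ ∪ 𝒞¬ᴿ.  The theorem
-- compares these g-independent descriptions for two choices of g.

open import Defs
open import Data.Nat using (ℕ; zero; suc)
open import Data.Bool using (Bool; true; false; not; _∧_; _∨_)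
open import Data.Bool.Properties using (∨-identityʳ; ∨-zeroʳ; ¬-not) renaming (_≟_ to _≟ᵇ_)
open import Data.Fin using (Fin; zero; suc; _≟_)
open import Data.Fin.Properties using (any?; all?)
open import Data.Fin.Subset using (Subset; _∈_; _∉_; _⊆_; _⊂_; _─_; _-_; _∪_; ⁅_⁆)
open import Data.Fin.Subset.Properties
  using (_∈?_; ⊆-antisym; p─q⊆p; x∈p∧x∉q⇒x∈p─q; x∈p∧x≢y⇒x∈p-y; x∈p∪q⁻; x∈p∪q⁺; x∈⁅x⁆; x∈⁅y⁆⇒x≡y)
open import Data.Vec using (_∷_; here; there; tabulate; lookup)
open import Data.Vec.Properties using (lookup∘tabulate; []=⇒lookup; lookup⇒[]=; ≡-dec)
open import Data.Product using (_×_; ∃; _,_; proj₁; proj₂)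
open import Data.Sum using (_⊎_; inj₁; inj₂; [_,_])
open import Data.Empty using (⊥; ⊥-elim)
open import Function.Base using (_∘_)
open import Function.Bundles using (_⇔_; mk⇔; Equivalence)
open import Function.Construct.Composition using (_⇔-∘_)
open import Function.Construct.Symmetry using (⇔-sym)
open import Relation.Nullary using (¬_; Dec; yes; no; contradiction)
open import Relation.Nullary.Decidable
  using (⌊_⌋; _×-dec_; _→-dec_; ¬?; decidable-stable; isYes≗does; dec-true; dec-false)
open import Relation.Binary.PropositionalEquality using (_≡_; _≢_; refl; sym; trans; cong; subst)

open Equivalence using (to; from)

private variable
  n k : ℕ

∧-true : ∀ {x y} → x ∧ y ≡ true → x ≡ true × y ≡ true
∧-true {true} {true} _ = refl , refl

∧-intro : ∀ {x y} → x ≡ true → y ≡ true → x ∧ y ≡ true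
∧-intro refl refl = refl

∨-true : ∀ {x y} → x ∨ y ≡ true → x ≡ true ⊎ y ≡ true
∨-true {true}  _   = inj₁ refl
∨-true {false} y≡t = inj₂ y≡t

not-true : ∀ {x} → not x ≡ true ⇔ x ≡ false
not-true {true}  = mk⇔ (λ ()) (λ ())
not-true {false} = mk⇔ (λ _ → refl) (λ _ → refl)

true≢false : true ≢ false
true≢false ()

implies-true : ∀ {x y} → not x ∨ y ≡ true ⇔ (x ≡ true → y ≡ true)
implies-true {true}  = mk⇔ (λ y≡t _ → y≡t) (λ f → f refl)
implies-true {false} = mk⇔ (λ _ ()) (λ _ → refl)

allᵇ-true : {p : Fin n → Bool} → allᵇ p ≡ true ⇔ (∀ i → p i ≡ true)
allᵇ-true {zero}  = mk⇔ (λ _ ()) (λ _ → refl)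
allᵇ-true {suc n} {p} = mk⇔ ⇒ ⇐
  where
  ⇒ : allᵇ p ≡ true → ∀ i → p i ≡ true
  ⇒ all-p zero    = proj₁ (∧-true all-p)
  ⇒ all-p (suc i) = to allᵇ-true (proj₂ (∧-true {p zero} all-p)) i
  ⇐ : (∀ i → p i ≡ true) → allᵇ p ≡ true
  ⇐ f rewrite f zero = from allᵇ-true (λ i → f (suc i))

anyᵇ-true : {p : Fin n → Bool} → anyᵇ p ≡ true ⇔ ∃ (λ i → p i ≡ true)
anyᵇ-true {zero}  = mk⇔ (λ ()) (λ ())
anyᵇ-true {suc n} {p} = mk⇔ ⇒ ⇐
  where
  ⇒ : anyᵇ p ≡ true → ∃ (λ i → p i ≡ true)
  ⇒ any-p with ∨-true {p zero} any-p
  ... | inj₁ p0   = zero , p0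
  ... | inj₂ rest = let (i , pi) = to anyᵇ-true rest in suc i , pi
  ⇐ : ∃ (λ i → p i ≡ true) → anyᵇ p ≡ true
  ⇐ (zero  , p0) rewrite p0 = refl
  ⇐ (suc i , pi) = trans (cong (p zero ∨_) (from anyᵇ-true (i , pi))) (∨-zeroʳ (p zero))

≟-self : (x : Fin n) → ⌊ x ≟ x ⌋ ≡ true
≟-self x = trans (isYes≗does (x ≟ x)) (dec-true (x ≟ x) refl)

≟-distinct : {x y : Fin n} → x ≢ y → ⌊ x ≟ y ⌋ ≡ false
≟-distinct {x = x} {y} x≢y = trans (isYes≗does (x ≟ y)) (dec-false (x ≟ y) x≢y)

not-≟-true : {x y : Fin n} → not ⌊ x ≟ y ⌋ ≡ true ⇔ x ≢ y
not-≟-true {x = x} {y} with x ≟ y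
... | yes x≡y = mk⇔ (λ ()) (λ x≢y → contradiction x≡y x≢y)
... | no x≢y  = mk⇔ (λ _ → x≢y) (λ _ → refl)

∈⇔lookup : {p : Subset n} {x : Fin n} → x ∈ p ⇔ lookup p x ≡ true
∈⇔lookup {p = p} {x} = mk⇔ []=⇒lookup (lookup⇒[]= x p)

∈-tabulate : {f : Fin n → Bool} {x : Fin n} → x ∈ tabulate f ⇔ f x ≡ true
∈-tabulate {f = f} {x} = mk⇔
  (λ x∈ → trans (sym (lookup∘tabulate f x)) ([]=⇒lookup x∈))
  (λ fx → lookup⇒[]= x (tabulate f) (trans (lookup∘tabulate f x) fx))

∈-comprehension : {P : Subset k} {r : Fin n → Fin k → Bool} {x : Fin n} →
  x ∈ tabulate (λ x → allᵇ (λ y → not (lookup P y) ∨ r x y))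
    ⇔ (∀ {y} → y ∈ P → r x y ≡ true)
∈-comprehension {P = P} {r} {x} = mk⇔
  (λ x∈ {y} y∈P → to implies-true (to allᵇ-true (to ∈-tabulate x∈) y) (to ∈⇔lookup y∈P))
  (λ f → from ∈-tabulate (from (allᵇ-true {p = λ y → not (lookup P y) ∨ r x y})
                              (λ y → from implies-true (λ y∈ → f (from ∈⇔lookup y∈)))))

x∈p─q⇒x∉q : ∀ {x : Fin n} (p q : Subset n) → x ∈ p ─ q → x ∉ q
x∈p─q⇒x∉q (_ ∷ p) (true  ∷ q) () here
x∈p─q⇒x∉q (_ ∷ p) (false ∷ q) here ()
x∈p─q⇒x∉q (_ ∷ p) (_     ∷ q) (there x∈) (there x∈q) = x∈p─q⇒x∉q p q x∈ x∈q

x∈p-y⇒x≢y : ∀ {x y : Fin n} (p : Subset n) → x ∈ p - y → x ≢ y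
x∈p-y⇒x≢y {y = y} p x∈ refl = x∈p─q⇒x∉q p ⁅ y ⁆ x∈ (x∈⁅x⁆ y)

x∈p-y⁻ : ∀ {x y : Fin n} (p : Subset n) → x ∈ p - y → x ∈ p × x ≢ y
x∈p-y⁻ {y = y} p x∈ = p─q⊆p p ⁅ y ⁆ x∈ , x∈p-y⇒x≢y p x∈

x∉p⇒p⊆p-x : ∀ {x : Fin n} {p : Subset n} → x ∉ p → p ⊆ p - x
x∉p⇒p⊆p-x x∉p y∈p = x∈p∧x≢y⇒x∈p-y y∈p (λ { refl → x∉p y∈p })

x∈p⇒p∪⁅x⁆≡p : ∀ {x : Fin n} {p : Subset n} → x ∈ p → p ∪ ⁅ x ⁆ ≡ p
x∈p⇒p∪⁅x⁆≡p {x = x} {p} x∈p = ⊆-antisym ⊆p (λ y∈ → x∈p∪q⁺ (inj₁ y∈))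
  where
  ⊆p : p ∪ ⁅ x ⁆ ⊆ p
  ⊆p y∈ with x∈p∪q⁻ p ⁅ x ⁆ y∈
  ... | inj₁ y∈p = y∈p
  ... | inj₂ y∈x rewrite x∈⁅y⁆⇒x≡y x y∈x = x∈p

x∈p⇒x≡y⊎x∈p-y : ∀ {x y : Fin n} {p : Subset n} → x ∈ p → x ≡ y ⊎ x ∈ p - y
x∈p⇒x≡y⊎x∈p-y {x = x} {y} x∈p with x ≟ y
... | yes x≡y = inj₁ x≡y
... | no x≢y  = inj₂ (x∈p∧x≢y⇒x∈p-y x∈p x≢y)

module Derivation (K : Incidence n k) where

  private variable
    X Y : Subset n
    B C : Subset k
    a h : Fin n
    b : Fin k

  ∈-up⁺ : ∀ X → (∀ {a} → a ∈ X → K a b ≡ true) → b ∈ up K X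
  ∈-up⁺ X = from ∈-comprehension

  ∈-up⁻ : b ∈ up K X → a ∈ X → K a b ≡ true
  ∈-up⁻ b∈ = to ∈-comprehension b∈

  ∈-down⁺ : ∀ B → (∀ {b} → b ∈ B → K a b ≡ true) → a ∈ down K B
  ∈-down⁺ B = from ∈-comprehension

  ∈-down⁻ : a ∈ down K B → b ∈ B → K a b ≡ true
  ∈-down⁻ a∈ = to ∈-comprehension a∈

  up-antitone : X ⊆ Y → up K Y ⊆ up K X
  up-antitone {X} X⊆Y b∈ = ∈-up⁺ X (λ a∈X → ∈-up⁻ b∈ (X⊆Y a∈X))

  down-antitone : B ⊆ C → down K C ⊆ down K B
  down-antitone {B} B⊆C a∈ = ∈-down⁺ B (λ b∈B → ∈-down⁻ a∈ (B⊆C b∈B))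

  cl-extensive : X ⊆ cl K X
  cl-extensive {X} a∈X = ∈-down⁺ (up K X) (λ b∈ → ∈-up⁻ b∈ a∈X)

  up-insert : ∀ X → b ∈ up K (X - h) → K h b ≡ true → b ∈ up K X
  up-insert {b} {h} X b∈ Khb = ∈-up⁺ X has-b
    where
    has-b : ∀ {a} → a ∈ X → K a b ≡ true
    has-b a∈X with x∈p⇒x≡y⊎x∈p-y {y = h} a∈X
    ... | inj₁ refl = Khb
    ... | inj₂ a∈   = ∈-up⁻ b∈ a∈

  up-absorb : X ⊆ Y → Y ⊆ cl K X → up K X ≡ up K Y
  up-absorb {Y = Y} X⊆Y Y⊆clX =
    ⊆-antisym (λ b∈ → ∈-up⁺ Y (λ a∈Y → ∈-down⁻ (Y⊆clX a∈Y) b∈)) (up-antitone X⊆Y)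

  cl-delete : ∀ X → h ∈ cl K (X - h) → cl K (X - h) ≡ cl K X
  cl-delete {h} X h∈ = cong (down K) (up-absorb (p─q⊆p X ⁅ h ⁆) X⊆)
    where
    X⊆ : X ⊆ cl K (X - h)
    X⊆ a∈X with x∈p⇒x≡y⊎x∈p-y {y = h} a∈X
    ... | inj₁ refl = h∈
    ... | inj₂ a∈   = cl-extensive a∈

  cl-insert : ∀ X → h ∈ cl K X → cl K X ≡ cl K (X ∪ ⁅ h ⁆)
  cl-insert {h} X h∈ = cong (down K) (up-absorb (λ a∈ → x∈p∪q⁺ (inj₁ a∈)) X∪⊆)
    where
    X∪⊆ : X ∪ ⁅ h ⁆ ⊆ cl K X
    X∪⊆ a∈ with x∈p∪q⁻ X ⁅ h ⁆ a∈
    ... | inj₁ a∈X = cl-extensive a∈X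
    ... | inj₂ a∈h rewrite x∈⁅y⁆⇒x≡y h a∈h = h∈

up-mono : {K K′ : Incidence n k} → (∀ {a b} → K a b ≡ true → K′ a b ≡ true) →
          ∀ X → up K X ⊆ up K′ X
up-mono {K = K} {K′} K⊆K′ X b∈ =
  Derivation.∈-up⁺ K′ X (λ a∈X → K⊆K′ (Derivation.∈-up⁻ K b∈ a∈X))

module AtAttribute (I : Incidence n k) (m : Fin k) where
  open Derivation I

  private variable
    S X Y : Subset n
    h : Fin n
    b : Fin k

  R : Subset n
  R = attrCo I m

  ∈R⇔ : h ∈ R ⇔ I h m ≡ false
  ∈R⇔ = not-true ⇔-∘ ∈-tabulate

  ∉R⇒ : h ∉ R → I h m ≡ true
  ∉R⇒ h∉R = ¬-not (λ Ihm≡false → h∉R (from ∈R⇔ Ihm≡false))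

  ∈R⇒m∉up : h ∈ X → h ∈ R → m ∉ up I X
  ∈R⇒m∉up h∈X h∈R m∈ = true≢false (trans (sym (∈-up⁻ m∈ h∈X)) (to ∈R⇔ h∈R))

  ─R⊆-x : ∀ S {x} → x ∈ R → S ─ R ⊆ S - x
  ─R⊆-x S x∈R a∈ = x∈p∧x≢y⇒x∈p-y (p─q⊆p S R a∈) (λ { refl → x∈p─q⇒x∉q S R a∈ x∈R })

  m∈up⇒⊆─R : X ⊆ S → m ∈ up I X → X ⊆ S ─ R
  m∈up⇒⊆─R X⊆S m∈ a∈X = x∈p∧x∉q⇒x∈p─q (X⊆S a∈X) (λ a∈R → ∈R⇒m∉up a∈X a∈R m∈)

  m∈up-split : ∀ X → m ∈ up I X ⊎ ∃ (λ a → a ∈ X × a ∈ R)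
  m∈up-split X with any? (λ a → (a ∈? X) ×-dec (a ∈? R))
  ... | yes witness = inj₂ witness
  ... | no none     = inj₁ (∈-up⁺ X (λ a∈X → ∉R⇒ (λ a∈R → none (_ , a∈X , a∈R))))

  up∖m : Subset n → Subset k
  up∖m X = up I X - m

  ∈-up∖m⁺ : ∀ X → b ∈ up I X → b ≢ m → b ∈ up∖m X
  ∈-up∖m⁺ X = x∈p∧x≢y⇒x∈p-y

  ∈-up∖m⁻ : ∀ X → b ∈ up∖m X → b ∈ up I X × b ≢ m
  ∈-up∖m⁻ X = x∈p-y⁻ (up I X)

  up∖m-antitone : X ⊆ Y → up∖m Y ⊆ up∖m X
  up∖m-antitone {X} {Y} X⊆Y b∈ =
    let (b∈up , b≢m) = ∈-up∖m⁻ Y b∈ in ∈-up∖m⁺ X (up-antitone X⊆Y b∈up) b≢m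

  ∈cl-via-up∖m : ∀ X → h ∈ down I (up∖m X) → (m ∈ up I X → I h m ≡ true) → h ∈ cl I X
  ∈cl-via-up∖m {h} X h∈ at-m = ∈-down⁺ (up I X) has
    where
    has : ∀ {b} → b ∈ up I X → I h b ≡ true
    has {b} b∈ with b ≟ m
    ... | yes refl = at-m b∈
    ... | no b≢m   = ∈-down⁻ h∈ (∈-up∖m⁺ X b∈ b≢m)

  ∈χ⁻ : ∀ S → h ∈ χ I m S → h ∈ R × ∃ (λ b → b ∈ up∖m S × I h b ≡ false)
  ∈χ⁻ {h} S h∈ =
    let (h∈R , some)  = ∧-true (to ∈-tabulate h∈)
        (b , found)   = to anyᵇ-true some
        (b∈ , rest)   = ∧-true found
        (lacks , b≢m) = ∧-true rest
    in from ∈⇔lookup h∈R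
     , b , ∈-up∖m⁺ S (from ∈⇔lookup b∈) (to not-≟-true b≢m)
     , to not-true (trans (sym (lookup∘tabulate (λ b → not (I h b)) b)) lacks)

  ∈χ⁺ : ∀ S → h ∈ R → b ∈ up∖m S → I h b ≡ false → h ∈ χ I m S
  ∈χ⁺ {h} {b} S h∈R b∈ lacks =
    let (b∈up , b≢m) = ∈-up∖m⁻ S b∈ in
    from ∈-tabulate (∧-intro (to ∈⇔lookup h∈R) (from anyᵇ-true (b ,
      ∧-intro (to ∈⇔lookup b∈up)
        (∧-intro (trans (lookup∘tabulate (λ b → not (I h b)) b) (from not-true lacks))
                 (from not-≟-true b≢m)))))

  χ⊆R : ∀ S → χ I m S ⊆ R
  χ⊆R S h∈ = proj₁ (∈χ⁻ S h∈)

  ∉χ⇒∈down : ∀ S → h ∈ R → h ∉ χ I m S → h ∈ down I (up∖m S)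
  ∉χ⇒∈down S h∈R h∉χ =
    ∈-down⁺ (up∖m S) (λ b∈ → ¬-not (λ lacks → h∉χ (∈χ⁺ S h∈R b∈ lacks)))

  ∈⇒∉χ : h ∈ S → h ∉ χ I m S
  ∈⇒∉χ {S = S} h∈S h∈χ =
    let (_ , b , b∈ , lacks) = ∈χ⁻ S h∈χ in
    true≢false (trans (sym (∈-up⁻ (proj₁ (∈-up∖m⁻ S b∈)) h∈S)) lacks)

  χ-antitone : X ⊆ Y → χ I m Y ⊆ χ I m X
  χ-antitone {X} {Y} X⊆Y h∈ =
    let (h∈R , b , b∈ , lacks) = ∈χ⁻ Y h∈ in ∈χ⁺ X h∈R (up∖m-antitone X⊆Y b∈) lacks

  χ⊆χ─R : ∀ S → χ I m S ⊆ χ I m (S ─ R)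
  χ⊆χ─R S = χ-antitone (p─q⊆p S R)

  -- A gap of S: an object that χ attaches to S ─ R but not to S.  As χ(S) is
  -- always contained in χ(S ─ R), a gap is what makes the inclusion proper.
  Gap : Subset n → Set
  Gap S = ∃ λ x → x ∈ χ I m (S ─ R) × x ∉ χ I m S

  χ-dichotomy : ∀ S → χ I m S ≡ χ I m (S ─ R) ⊎ Gap S
  χ-dichotomy S with any? (λ x → (x ∈? χ I m (S ─ R)) ×-dec ¬? (x ∈? χ I m S))
  ... | yes gap   = inj₂ gap
  ... | no no-gap = inj₁ (⊆-antisym (χ⊆χ─R S) (λ {x} x∈ →
          decidable-stable (x ∈? χ I m S) (λ x∉ → no-gap (x , x∈ , x∉))))

  gap-attribute : ∀ S → Gap S → ∃ λ b → b ∈ up∖m (S ─ R) × b ∉ up I S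
  gap-attribute S (x , x∈ , x∉) =
    let (x∈R , b , b∈ , lacks) = ∈χ⁻ (S ─ R) x∈
        b≢m   = proj₂ (∈-up∖m⁻ (S ─ R) b∈)
        x-has = ∉χ⇒∈down S x∈R x∉
    in b , b∈ , λ b∈S → true≢false (trans (sym (∈-down⁻ x-has (∈-up∖m⁺ S b∈S b≢m))) lacks)

  -- If S shares m then S ⊆ S ─ R, so S has no gap.
  gap⇒m∉up : ∀ S → Gap S → m ∉ up I S
  gap⇒m∉up S (x , x∈ , x∉) m∈ = x∉ (χ-antitone (m∈up⇒⊆─R {X = S} (λ a∈ → a∈) m∈) x∈)

  absorbed : ∀ S → χ I m S ≡ χ I m (S ─ R) → h ∈ S → h ∈ R → S ─ R ⊆ X →
             h ∈ down I (up∖m X)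
  absorbed {h} S χ≡ h∈S h∈R ⊆X = down-antitone (up∖m-antitone ⊆X)
    (∉χ⇒∈down (S ─ R) h∈R (λ h∈ → ∈⇒∉χ h∈S (subst (h ∈_) (sym χ≡) h∈)))

  -- The heart of the argument: if an R-mixed generator S has a gap, no member h
  -- of S ∩ R has all attributes of (S - h)^I ∖ {m}.  Otherwise either h would
  -- lie in the closure of S - h, or S would share the attribute of the gap.
  gap⇒irredundant : MixedGen I R S → Gap S → h ∈ S → h ∈ R → h ∉ down I (up∖m (S - h))
  gap⇒irredundant {S} {h} mixed gap h∈S h∈R h-has
    with gap-attribute S gap | m ∈? up I (S - h)
  ... | b , b∈ , b∉ | yes m∈ = b∉ (up-insert S (proj₁ (∈-up∖m⁻ (S - h) b∈′)) (∈-down⁻ h-has b∈′))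
    where
    b∈′ : b ∈ up∖m (S - h)
    b∈′ = up∖m-antitone (m∈up⇒⊆─R (p─q⊆p S ⁅ h ⁆) m∈) b∈
  ... | _ | no m∉ =
    proj₁ (mixed h) (h∈S , h∈R)
      (cl-delete S (∈cl-via-up∖m (S - h) h-has (λ m∈ → contradiction m∈ m∉)))

  module Opposite (g : Fin n) (g∈R : g ∈ R) where

    J : Incidence n k
    J = op g m I

    module L = Derivation J

    J-entry : ∀ {h b p q} → ⌊ h ≟ g ⌋ ≡ p → ⌊ b ≟ m ⌋ ≡ q →
              J h b ≡ I h b ∨ (p ∧ not q) ∨ (not p ∧ q)
    J-entry refl refl = refl

    J-g-m : J g m ≡ false
    J-g-m = trans (J-entry (≟-self g) (≟-self m)) (trans (∨-identityʳ (I g m)) (to ∈R⇔ g∈R))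

    J-g-b : b ≢ m → J g b ≡ true
    J-g-b {b} b≢m = trans (J-entry (≟-self g) (≟-distinct b≢m)) (∨-zeroʳ (I g b))

    J-h-m : h ≢ g → J h m ≡ true
    J-h-m {h} h≢g = trans (J-entry (≟-distinct h≢g) (≟-self m)) (∨-zeroʳ (I h m))

    J-h-b : h ≢ g → b ≢ m → J h b ≡ I h b
    J-h-b {h} {b} h≢g b≢m =
      trans (J-entry (≟-distinct h≢g) (≟-distinct b≢m)) (∨-identityʳ (I h b))

    I⇒J : ∀ {h b} → I h b ≡ true → J h b ≡ true
    I⇒J Ihb = cong (_∨ _) Ihb

    upI⊆upJ : ∀ X → up I X ⊆ up J X
    upI⊆upJ = up-mono I⇒J

    m∈upJ⁺ : g ∉ X → m ∈ up J X
    m∈upJ⁺ {X} g∉X = L.∈-up⁺ X (λ a∈X → J-h-m (λ { refl → g∉X a∈X }))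

    m∈upJ⁻ : ∀ X → m ∈ up J X → g ∉ X
    m∈upJ⁻ X m∈ g∈X = true≢false (trans (sym (L.∈-up⁻ m∈ g∈X)) J-g-m)

    ∈upJ⁺ : ∀ X → b ≢ m → b ∈ up I (X - g) → b ∈ up J X
    ∈upJ⁺ {b} X b≢m b∈ = L.∈-up⁺ X has
      where
      has : ∀ {a} → a ∈ X → J a b ≡ true
      has a∈X with x∈p⇒x≡y⊎x∈p-y {y = g} a∈X
      ... | inj₁ refl = J-g-b b≢m
      ... | inj₂ a∈   = I⇒J (∈-up⁻ b∈ a∈)

    ∈upJ⁻ : ∀ X → b ≢ m → b ∈ up J X → b ∈ up I (X - g)
    ∈upJ⁻ X b≢m b∈ = ∈-up⁺ (X - g) λ a∈ →
      let (a∈X , a≢g) = x∈p-y⁻ X a∈ in trans (sym (J-h-b a≢g b≢m)) (L.∈-up⁻ b∈ a∈X)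

    g∉clJ : g ∉ X → g ∉ cl J X
    g∉clJ g∉X g∈ = true≢false (trans (sym (L.∈-down⁻ g∈ (m∈upJ⁺ g∉X))) J-g-m)

    ∈clJ⇒ : ∀ X → h ≢ g → h ∈ cl J X → h ∈ down I (up∖m (X - g))
    ∈clJ⇒ X h≢g h∈ = ∈-down⁺ (up∖m (X - g)) λ b∈ →
      let (b∈up , b≢m) = ∈-up∖m⁻ (X - g) b∈ in
      trans (sym (J-h-b h≢g b≢m)) (L.∈-down⁻ h∈ (∈upJ⁺ X b≢m b∈up))

    upJ⊆upI⇒≡ : ∀ S → up J S ⊆ up I S → up J S ≡ up I S
    upJ⊆upI⇒≡ S ⊆I = ⊆-antisym ⊆I (upI⊆upJ S)

    upJ≡upI-outside : ∀ S → g ∉ S → m ∈ up I S → up J S ≡ up I S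
    upJ≡upI-outside S g∉S m∈ = upJ⊆upI⇒≡ S ⊆I
      where
      ⊆I : up J S ⊆ up I S
      ⊆I {b} b∈ with b ≟ m
      ... | yes refl = m∈
      ... | no b≢m   = up-antitone (x∉p⇒p⊆p-x g∉S) (∈upJ⁻ S b≢m b∈)

    upJ≡upI-inside⁺ : ∀ S → g ∈ S → g ∈ down I (up∖m (S - g)) → up J S ≡ up I S
    upJ≡upI-inside⁺ S g∈S g-has = upJ⊆upI⇒≡ S ⊆I
      where
      ⊆I : up J S ⊆ up I S
      ⊆I {b} b∈ with b ≟ m
      ... | yes refl = contradiction g∈S (m∈upJ⁻ S b∈)
      ... | no b≢m   = let b∈′ = ∈upJ⁻ S b≢m b∈ in
        up-insert S b∈′ (∈-down⁻ g-has (∈-up∖m⁺ (S - g) b∈′ b≢m))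

    upJ≡upI-inside⁻ : ∀ S → g ∈ S → up J S ≡ up I S → g ∈ down I (up∖m (S - g))
    upJ≡upI-inside⁻ S g∈S J≡I = ∈-down⁺ (up∖m (S - g)) λ b∈ →
      let (b∈up , b≢m) = ∈-up∖m⁻ (S - g) b∈ in
      ∈-up⁻ (subst (_ ∈_) J≡I (∈upJ⁺ S b≢m b∈up)) g∈S

    upJ-delete : ∀ S → g ∉ S → h ∈ down I (up∖m (S - h)) → up J (S - h) ≡ up J S
    upJ-delete {h} S g∉S h-has = ⊆-antisym ⊆S (L.up-antitone (p─q⊆p S ⁅ h ⁆))
      where
      S-h⊆ : S - h ⊆ S - h - g
      S-h⊆ = x∉p⇒p⊆p-x (λ g∈ → g∉S (proj₁ (x∈p-y⁻ S g∈)))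

      ⊆S : up J (S - h) ⊆ up J S
      ⊆S {b} b∈ with b ≟ m
      ... | yes refl = m∈upJ⁺ g∉S
      ... | no b≢m   = let b∈′ = up-antitone S-h⊆ (∈upJ⁻ (S - h) b≢m b∈) in
        upI⊆upJ S (up-insert S b∈′ (∈-down⁻ h-has (∈-up∖m⁺ (S - h) b∈′ b≢m)))

    -- Condition (ii) for R-mixed generators passes from I to L: an object h ∉ R
    -- in the L-closure of S has all attributes of S^I, m included.
    insertion-preserved : MixedGen I R S → h ∉ S → h ∉ R → cl J (S ∪ ⁅ h ⁆) ≢ cl J S
    insertion-preserved {S} {h} mixed h∉S h∉R clJ≡ =
      proj₂ (mixed h) (h∉S , h∉R) (sym (cl-insert S h∈clS))
      where
      h≢g : h ≢ g
      h≢g refl = h∉R g∈R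

      h∈clJS : h ∈ cl J S
      h∈clJS = subst (h ∈_) clJ≡ (L.cl-extensive (x∈p∪q⁺ {p = S} (inj₂ (x∈⁅x⁆ h))))

      h∈clS : h ∈ cl I S
      h∈clS = ∈cl-via-up∖m S
        (down-antitone (up∖m-antitone (p─q⊆p S ⁅ g ⁆)) (∈clJ⇒ S h≢g h∈clJS)) (λ _ → ∉R⇒ h∉R)

    gap⇒mixedJ : MixedGen I R S → Gap S → MixedGen J R S
    gap⇒mixedJ {S} mixed gap h = deletion , λ (h∉S , h∉R) → insertion-preserved mixed h∉S h∉R
      where
      deletion : h ∈ S × h ∈ R → cl J (S - h) ≢ cl J S
      deletion (h∈S , h∈R) clJ≡ = by-cases (h ≟ g) (subst (h ∈_) (sym clJ≡) (L.cl-extensive h∈S))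
        where
        by-cases : Dec (h ≡ g) → h ∈ cl J (S - h) → ⊥
        by-cases (yes refl) h∈ = g∉clJ (λ g∈ → x∈p-y⇒x≢y S g∈ refl) h∈
        by-cases (no h≢g)   h∈ = gap⇒irredundant mixed gap h∈S h∈R
          (down-antitone (up∖m-antitone (p─q⊆p (S - h) ⁅ g ⁆)) (∈clJ⇒ (S - h) h≢g h∈))

    gap⇒upJ≢upI : MixedGen I R S → Gap S → up J S ≢ up I S
    gap⇒upJ≢upI {S} mixed gap J≡I with g ∈? S
    ... | yes g∈S = gap⇒irredundant mixed gap g∈S g∈R (upJ≡upI-inside⁻ S g∈S J≡I)
    ... | no g∉S  = gap⇒m∉up S gap (subst (m ∈_) J≡I (m∈upJ⁺ g∉S))

    noGap⇒upJ≡upI : ∀ S → MixedGen J R S → χ I m S ≡ χ I m (S ─ R) → up J S ≡ up I S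
    noGap⇒upJ≡upI S mixedJ χ≡ with g ∈? S | m∈up-split S
    ... | yes g∈S | _      = upJ≡upI-inside⁺ S g∈S (absorbed S χ≡ g∈S g∈R (─R⊆-x S g∈R))
    ... | no g∉S  | inj₁ m∈ = upJ≡upI-outside S g∉S m∈
    ... | no g∉S  | inj₂ (h , h∈S , h∈R) =
      contradiction (cong (down J) (upJ-delete S g∉S (absorbed S χ≡ h∈S h∈R (─R⊆-x S h∈R))))
                    (proj₁ (mixedJ h) (h∈S , h∈R))

    disjoint⇒mixedJ : MixedGen I R S → (∀ {h} → h ∈ S → h ∉ R) → MixedGen J R S
    disjoint⇒mixedJ mixed disjoint h =
      (λ (h∈S , h∈R) _ → disjoint h∈S h∈R) , λ (h∉S , h∉R) → insertion-preserved mixed h∉S h∉R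

    mixedJ? : ∀ S → Dec (MixedGen J R S)
    mixedJ? S = all? λ h →
        ((h ∈? S ×-dec h ∈? R) →-dec ¬? (≡-dec _≟ᵇ_ (cl J (S - h)) (cl J S)))
      ×-dec
        ((¬? (h ∈? S) ×-dec ¬? (h ∈? R)) →-dec ¬? (≡-dec _≟ᵇ_ (cl J (S ∪ ⁅ h ⁆)) (cl J S)))

    open Classes I m g using (𝒩; 𝒜; ℬ; 𝒞; 𝒞ᴿ; 𝒞¬ᴿ; 𝒜χ=R)

    -- The class ℬ contains no superset of R: for R ⊆ S we have g ∈ S, so S ∪ {g} = S.
    ℬ⇒R⊈S : ∀ {S} → ℬ S → ¬ (R ⊆ S)
    ℬ⇒R⊈S {S} (_ , J≢I , J∪g≡I) R⊆S =
      J≢I (subst (λ X → up J X ≡ up I S) (x∈p⇒p∪⁅x⁆≡p (R⊆S g∈R)) J∪g≡I)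

    module Classification {S : Subset n} (mixed : MixedGen I R S) where

      gap⇒ℬ⊎𝒞 : Gap S → ℬ S ⊎ 𝒞 S
      gap⇒ℬ⊎𝒞 gap = classify (≡-dec _≟ᵇ_ (up J (S ∪ ⁅ g ⁆)) (up I S))
        where
        not-𝒩 : ¬ 𝒩 S
        not-𝒩 not-mixed = not-mixed (gap⇒mixedJ mixed gap)

        classify : Dec (up J (S ∪ ⁅ g ⁆) ≡ up I S) → ℬ S ⊎ 𝒞 S
        classify (yes J∪g≡I) = inj₁ (not-𝒩 , gap⇒upJ≢upI mixed gap , J∪g≡I)
        classify (no J∪g≢I)  = inj₂ (not-𝒩 , gap⇒upJ≢upI mixed gap , J∪g≢I)

      -- Members of ℬ ∪ 𝒞 are R-mixed generators of L with S^J ≠ S^I, so they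
      -- cannot be gap-free.
      ℬ⊎𝒞⇒gap : ℬ S ⊎ 𝒞 S → Gap S
      ℬ⊎𝒞⇒gap class with χ-dichotomy S
      ... | inj₂ gap = gap
      ... | inj₁ χ≡  = contradiction (noGap⇒upJ≡upI S mixedJ χ≡) J≢I
        where
        not-𝒩 : ¬ 𝒩 S
        not-𝒩 = [ proj₁ , proj₁ ] class
        J≢I : up J S ≢ up I S
        J≢I = [ proj₁ ∘ proj₂ , proj₁ ∘ proj₂ ] class
        mixedJ : MixedGen J R S
        mixedJ = decidable-stable (mixedJ? S) not-𝒩

      𝒩⊎𝒜⇔ : (𝒩 S ⊎ 𝒜 S) ⇔ (χ I m S ≡ χ I m (S ─ R))
      𝒩⊎𝒜⇔ = mk⇔ ⇒ ⇐
        where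
        ⇒ : 𝒩 S ⊎ 𝒜 S → χ I m S ≡ χ I m (S ─ R)
        ⇒ class with χ-dichotomy S | class
        ... | inj₁ χ≡  | _                = χ≡
        ... | inj₂ gap | inj₁ not-mixed   = contradiction (gap⇒mixedJ mixed gap) not-mixed
        ... | inj₂ gap | inj₂ (_ , J≡I)  = contradiction J≡I (gap⇒upJ≢upI mixed gap)
        ⇐ : χ I m S ≡ χ I m (S ─ R) → 𝒩 S ⊎ 𝒜 S
        ⇐ χ≡ with mixedJ? S
        ... | no not-mixed = inj₁ not-mixed
        ... | yes mixedJ   = inj₂ ((λ not-mixed → not-mixed mixedJ) , noGap⇒upJ≡upI S mixedJ χ≡)

      ℬ⊎𝒞⇔ : (ℬ S ⊎ 𝒞 S) ⇔ (χ I m S ⊂ χ I m (S ─ R))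
      ℬ⊎𝒞⇔ = mk⇔ (λ class → (λ {x} → χ⊆χ─R S {x}) , ℬ⊎𝒞⇒gap class) (gap⇒ℬ⊎𝒞 ∘ proj₂)

      -- χ(S) = R forces S to avoid R, hence S ∈ 𝒜 for every choice of g.
      𝒜χ=R⇔ : 𝒜χ=R S ⇔ (χ I m S ≡ R)
      𝒜χ=R⇔ = mk⇔ proj₂ ⇐
        where
        ⇐ : χ I m S ≡ R → 𝒜χ=R S
        ⇐ χ≡R = ((λ not-mixed → not-mixed mixedJ) , noGap⇒upJ≡upI S mixedJ χ≡) , χ≡R
          where
          disjoint : ∀ {h} → h ∈ S → h ∉ R
          disjoint {h} h∈S h∈R = ∈⇒∉χ h∈S (subst (h ∈_) (sym χ≡R) h∈R)
          mixedJ : MixedGen J R S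
          mixedJ = disjoint⇒mixedJ mixed disjoint
          χ≡ : χ I m S ≡ χ I m (S ─ R)
          χ≡ = ⊆-antisym (χ⊆χ─R S) (λ {h} h∈ → subst (h ∈_) (sym χ≡R) (χ⊆R (S ─ R) h∈))

      -- With R ⊆ S the class ℬ is excluded, so 𝒞ᴿ is "a gap and R ⊆ S".
      𝒞ᴿ⇔ : 𝒞ᴿ S ⇔ (χ I m S ⊂ χ I m (S ─ R) × R ⊆ S)
      𝒞ᴿ⇔ = mk⇔ (λ (c , R⊆S) → to ℬ⊎𝒞⇔ (inj₂ c) , R⊆S) ⇐
        where
        ⇐ : χ I m S ⊂ χ I m (S ─ R) × R ⊆ S → 𝒞ᴿ S
        ⇐ (⊂ , R⊆S) with from ℬ⊎𝒞⇔ ⊂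
        ... | inj₁ b = ⊥-elim (ℬ⇒R⊈S b R⊆S)
        ... | inj₂ c = c , R⊆S

      ℬ⊎𝒞¬ᴿ⇔ : (ℬ S ⊎ 𝒞¬ᴿ S) ⇔ (χ I m S ⊂ χ I m (S ─ R) × ¬ (R ⊆ S))
      ℬ⊎𝒞¬ᴿ⇔ = mk⇔ ⇒ ⇐
        where
        ⇒ : ℬ S ⊎ 𝒞¬ᴿ S → χ I m S ⊂ χ I m (S ─ R) × ¬ (R ⊆ S)
        ⇒ (inj₁ b)        = to ℬ⊎𝒞⇔ (inj₁ b) , ℬ⇒R⊈S b
        ⇒ (inj₂ (c , R⊈S)) = to ℬ⊎𝒞⇔ (inj₂ c) , R⊈S
        ⇐ : χ I m S ⊂ χ I m (S ─ R) × ¬ (R ⊆ S) → ℬ S ⊎ 𝒞¬ᴿ S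
        ⇐ (⊂ , R⊈S) with from ℬ⊎𝒞⇔ ⊂
        ... | inj₁ b = inj₁ b
        ... | inj₂ c = inj₂ (c , R⊈S)

⇔-via : {A B C : Set} → A ⇔ C → B ⇔ C → A ⇔ B
⇔-via A⇔C B⇔C = ⇔-sym B⇔C ⇔-∘ A⇔C

lemma1 : {n k : ℕ} (I : Incidence n k) (m : Fin k) →
    ∃ (λ g₀ → g₀ ∈ attrCo I m) →
    (𝒮 : Subset n → Set) → CompleteSystem I (attrCo I m) 𝒮 →
    ((g g′ : Fin n) → g ∈ attrCo I m → g′ ∈ attrCo I m →
      (S : Subset n) → 𝒮 S →
        (Classes.𝒜χ=R I m g S ⇔ Classes.𝒜χ=R I m g′ S)
      × (Classes.𝒞ᴿ I m g S ⇔ Classes.𝒞ᴿ I m g′ S))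
    × ((g : Fin n) → g ∈ attrCo I m → (S : Subset n) → 𝒮 S →
        ((Classes.𝒩 I m g S ⊎ Classes.𝒜 I m g S)
          ⇔ (χ I m S ≡ χ I m (S ─ attrCo I m)))
      × ((Classes.ℬ I m g S ⊎ Classes.𝒞 I m g S)
          ⇔ (χ I m S ⊂ χ I m (S ─ attrCo I m))))
    × ((g g′ : Fin n) → g ∈ attrCo I m → g′ ∈ attrCo I m →
      (S : Subset n) → 𝒮 S →
        ((Classes.ℬ I m g S ⊎ Classes.𝒞¬ᴿ I m g S)
          ⇔ (Classes.ℬ I m g′ S ⊎ Classes.𝒞¬ᴿ I m g′ S)))
lemma1 {n} I m _ 𝒮 (generators , _) =
    (λ g g′ g∈R g′∈R S S∈𝒮 →
        ⇔-via (At.𝒜χ=R⇔ g g∈R S∈𝒮) (At.𝒜χ=R⇔ g′ g′∈R S∈𝒮)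
      , ⇔-via (At.𝒞ᴿ⇔ g g∈R S∈𝒮) (At.𝒞ᴿ⇔ g′ g′∈R S∈𝒮))
  , (λ g g∈R S S∈𝒮 → At.𝒩⊎𝒜⇔ g g∈R S∈𝒮 , At.ℬ⊎𝒞⇔ g g∈R S∈𝒮)
  , (λ g g′ g∈R g′∈R S S∈𝒮 → ⇔-via (At.ℬ⊎𝒞¬ᴿ⇔ g g∈R S∈𝒮) (At.ℬ⊎𝒞¬ᴿ⇔ g′ g′∈R S∈𝒮))
  where
  module At (g : Fin n) (g∈R : g ∈ attrCo I m) {S : Subset n} (S∈𝒮 : 𝒮 S) =
    AtAttribute.Opposite.Classification I m g g∈R (generators S S∈𝒮)
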